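{- Let $G$ be a hypergraph, let $A\subseteq E(G)$ be well-linked in $G$, and let $B\subseteq E(G\triangleleft A)$ be well-linked in $G\triangleleft A$. Then $B\triangleright A$ is well-linked in $G$.
   Context: A hypergraph $G$ consists of finite sets $V(G)$, $E(G)$ and for each hyperedge $e$ a set $V(e)\subseteq V(G)$ (distinct hyperedges may share vertex sets), every vertex lying in some $V(e)$. For $A\subseteq E(G)$: $V(A)=\bigcup_{e\in A}V(e)$, $\overline A=E(G)\setminus A$, $\mathrm{bd}(A)=V(A)\cap V(\overline A)$, $\lambda(A)=|\mathrm{bd}(A)|$ (computed in the hypergraph under consideration). $A$ is well-linked if for every pair $(B_1,B_2)$ of disjoint, possibly empty, sets with $B_1\cup B_2=A$, $\lambda(B_1)\ge\lambda(A)$ or $\lambda(B_2)\ge\lambda(A)$. $G\triangleleft A$ is the hypergraph with vertex set $V(\overline A)$ and hyperedge set $\overline A\cup\{e_A\}$ for a new hyperedge $e_A$ with $V(e_A)=\mathrm{bd}(A)$. For $B\subseteq E(G\triangleleft A)$, $B\triangleright A=B$ if $e_A\notin B$, and $B\triangleright A=(B\setminus\{e_A\})\cup A$ if $e_A\in B$. -}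

module Defs where

open import Data.Nat using (ℕ; suc; _≥_)
open import Data.Fin using (Fin; zero; suc)
open import Data.Fin.Subset using (Subset; _∈_; _⊆_; _∩_; _∪_; _─_; ⋃; ∣_∣; ⊥)
open import Data.Vec using (_∷_; lookup)
open import Data.List using (map; allFin)
open import Data.Bool using (Bool; true; false; if_then_else_)
open import Data.Product using (∃; _×_)
open import Data.Sum using (_⊎_)
open import Relation.Binary.PropositionalEquality using (_≡_)

-- V(G) = VG, E(G) = EG,
-- V(e) = inc e (only meaningful for e ∈ EG).  Distinct hyperedges may share
-- vertex sets.
record Hypergraph : Set where
  field
    n  : ℕ
    m  : ℕ
    VG : Subset n
    EG : Subset m
    inc : Fin m → Subset n

open Hypergraph public

WellFormed : Hypergraph → Set
WellFormed G =
  (∀ e → e ∈ EG G → inc G e ⊆ VG G) ×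
  (∀ v → v ∈ VG G → ∃ λ e → e ∈ EG G × v ∈ inc G e)

Vof : (G : Hypergraph) → Subset (m G) → Subset (n G)
Vof G A = ⋃ (map (λ e → if lookup A e then inc G e else ⊥) (allFin (m G)))

compl : (G : Hypergraph) → Subset (m G) → Subset (m G)
compl G A = EG G ─ A

bd : (G : Hypergraph) → Subset (m G) → Subset (n G)
bd G A = Vof G A ∩ Vof G (compl G A)

lam : (G : Hypergraph) → Subset (m G) → ℕ
lam G A = ∣ bd G A ∣

WellLinked : (G : Hypergraph) → Subset (m G) → Set
WellLinked G A =
  ∀ (B₁ B₂ : Subset (m G)) → B₁ ∩ B₂ ≡ ⊥ → B₁ ∪ B₂ ≡ A →
  lam G B₁ ≥ lam G A ⊎ lam G B₂ ≥ lam G A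

-- G ◁ A : vertex set V(Ā), hyperedges Ā ∪ {e_A}, where the new hyperedge
-- e_A is the index zero of Fin (suc m) and the old hyperedge e is suc e.
_◁_ : (G : Hypergraph) → Subset (m G) → Hypergraph
G ◁ A = record
  { n = n G
  ; m = suc (m G)
  ; VG = Vof G (compl G A)
  ; EG = true ∷ compl G A
  ; inc = λ { zero → bd G A ; (suc e) → inc G e }
  }

_▷_ : {G : Hypergraph} → Subset (suc (m G)) → Subset (m G) → Subset (m G)
(false ∷ B) ▷ A = B
(true ∷ B) ▷ A = B ∪ A

-- Take a partition (C₁, C₂) of B ▷ A.  Passing between G and G ◁ A preserves
-- boundaries: bd_{G◁A}(Y) = bd_G(Y ▷ A).  So if e_A ∉ B the partition lifts
-- unchanged.  If e_A ∈ B, well-linkedness of A lets us assume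
-- λ(A ∩ C₁) ≥ λ(A), and we split B as (e_A + (C₁ − A), C₂ − A).  Submodularity
-- λ(C₁ ∪ A) + λ(C₁ ∩ A) ≤ λ(C₁) + λ(A) gives λ(C₁ ∪ A) ≤ λ(C₁), and
-- posimodularity λ(C₂ − A) + λ(A − C₂) ≤ λ(C₂) + λ(A), with A − C₂ = A ∩ C₁,
-- gives λ(C₂ − A) ≤ λ(C₂).

module Submission where

open import Defs
open import Data.Bool using (if_then_else_)
open import Data.Bool.Properties using (∨-zeroʳ)
open import Data.Fin using (Fin; zero; suc)
open import Data.Fin.Subset using (Subset; _⊆_; _∈_; _∉_; _∩_; _∪_; _─_; ⋃; ∣_∣; ⊥; inside; outside)
open import Data.Fin.Subset.Properties
  using ( _∈?_; ∉⊥; ⊥⊆; ⊆-antisym; drop-∷-⊆; out⊆; in⊆in; p⊆q⇒∣p∣≤∣q∣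
        ; x∈p∩q⁺; x∈p∩q⁻; p∩q⊆p; p∩q⊆q; x∈p∪q⁺; x∈p∪q⁻; p⊆p∪q; q⊆p∪q
        ; x∈p∧x∉q⇒x∈p─q; p─q⊆p; p─q─r≡p─q∪r; p─q─r≡p─r─q
        ; ∩-comm; ∪-comm; ∩-distribˡ-∪; ∩-abs-∪ )
open import Data.List using (List; []; _∷_; map; allFin)
open import Data.List.Relation.Unary.Any using (Any; here; there; satisfied)
open import Data.List.Relation.Unary.Any.Properties using (map⁺; map⁻)
open import Data.List.Membership.Propositional using (lose)
open import Data.List.Membership.Propositional.Properties using (∈-allFin)
open import Data.Nat using (ℕ; suc; _+_; _≤_; _≥_)
open import Data.Nat.Properties
  using (+-suc; +-mono-≤; +-monoʳ-≤; +-cancelʳ-≤; ≤-trans; module ≤-Reasoning)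
open import Data.Product using (∃; _×_; _,_; proj₁; proj₂)
open import Data.Sum using (_⊎_; inj₁; inj₂; [_,_]′; swap)
import Data.Sum as Sum
open import Data.Vec using (_∷_; []; here; there; lookup)
open import Data.Vec.Properties using ([]=⇒lookup; lookup⇒[]=)
open import Function using (id; _∘_)
open import Relation.Binary.PropositionalEquality
  using (_≡_; refl; sym; trans; cong; cong₂; subst; subst₂; module ≡-Reasoning)
open import Relation.Nullary using (yes; no; contradiction)

private
  variable
    k : ℕ
    x : Fin k
    p q r s : Subset k

x∈p─q⇒x∉q : ∀ (p q : Subset k) → x ∈ p ─ q → x ∉ q
x∈p─q⇒x∉q (_ ∷ p) (outside ∷ q) here      ()
x∈p─q⇒x∉q (_ ∷ p) (_       ∷ q) (there h) (there h′) = x∈p─q⇒x∉q p q h h′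

x∈⋃⁻ : ∀ (ps : List (Subset k)) → x ∈ ⋃ ps → Any (x ∈_) ps
x∈⋃⁻ []       h = contradiction h ∉⊥
x∈⋃⁻ (p ∷ ps) h = [ here , there ∘ x∈⋃⁻ ps ]′ (x∈p∪q⁻ p (⋃ ps) h)

x∈⋃⁺ : ∀ {ps : List (Subset k)} → Any (x ∈_) ps → x ∈ ⋃ ps
x∈⋃⁺ (here h)  = x∈p∪q⁺ (inj₁ h)
x∈⋃⁺ (there h) = x∈p∪q⁺ (inj₂ (x∈⋃⁺ h))

x∈if⊥⁻ : ∀ b → x ∈ (if b then p else ⊥) → b ≡ inside × x ∈ p
x∈if⊥⁻ inside  h = refl , h
x∈if⊥⁻ outside h = contradiction h ∉⊥

─-monoˡ : p ⊆ q → p ─ r ⊆ q ─ r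
─-monoˡ {p = p} {r = r} p⊆q h = x∈p∧x∉q⇒x∈p─q (p⊆q (p─q⊆p p r h)) (x∈p─q⇒x∉q p r h)

─-distribʳ-∪ : ∀ (p q r : Subset k) → (p ∪ q) ─ r ≡ (p ─ r) ∪ (q ─ r)
─-distribʳ-∪ []      []      []            = refl
─-distribʳ-∪ (_ ∷ p) (_ ∷ q) (inside  ∷ r) = cong (outside ∷_) (─-distribʳ-∪ p q r)
─-distribʳ-∪ (_ ∷ p) (_ ∷ q) (outside ∷ r) = cong (_ ∷_) (─-distribʳ-∪ p q r)

p─q∪q≡p∪q : ∀ (p q : Subset k) → (p ─ q) ∪ q ≡ p ∪ q
p─q∪q≡p∪q []      []            = refl
p─q∪q≡p∪q (b ∷ p) (inside  ∷ q) = cong₂ _∷_ (sym (∨-zeroʳ b)) (p─q∪q≡p∪q p q)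
p─q∪q≡p∪q (_ ∷ p) (outside ∷ q) = cong (_ ∷_) (p─q∪q≡p∪q p q)

p⊆q⇒q∪p≡q : p ⊆ q → q ∪ p ≡ q
p⊆q⇒q∪p≡q {p = p} {q = q} p⊆q = ⊆-antisym ([ id , p⊆q ]′ ∘ x∈p∪q⁻ q p) (p⊆p∪q p)

p⊆r─q⇒p∪q─q≡p : p ⊆ r ─ q → (p ∪ q) ─ q ≡ p
p⊆r─q⇒p∪q─q≡p {p = p} {r = r} {q = q} p⊆r─q = ⊆-antisym ⊆p p⊆
  where
  ⊆p : (p ∪ q) ─ q ⊆ p
  ⊆p h = [ id , (λ h′ → contradiction h′ (x∈p─q⇒x∉q (p ∪ q) q h)) ]′
           (x∈p∪q⁻ p q (p─q⊆p (p ∪ q) q h))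
  p⊆ : p ⊆ (p ∪ q) ─ q
  p⊆ h = x∈p∧x∉q⇒x∈p─q (x∈p∪q⁺ (inj₁ h)) (x∈p─q⇒x∉q r q (p⊆r─q h))

p─q─r∪q≡p─r : q ⊆ p → r ⊆ p ─ q → (p ─ q ─ r) ∪ q ≡ p ─ r
p─q─r∪q≡p─r {q = q} {p = p} {r = r} q⊆p r⊆p─q = begin
  (p ─ q ─ r) ∪ q ≡⟨ cong (_∪ q) (p─q─r≡p─r─q p q r) ⟩
  (p ─ r ─ q) ∪ q ≡⟨ p─q∪q≡p∪q (p ─ r) q ⟩
  (p ─ r) ∪ q     ≡⟨ p⊆q⇒q∪p≡q q⊆p─r ⟩
  p ─ r           ∎
  where
  open ≡-Reasoning
  q⊆p─r : q ⊆ p ─ r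
  q⊆p─r h = x∈p∧x∉q⇒x∈p─q (q⊆p h) (λ h′ → x∈p─q⇒x∉q p q (r⊆p─q h′) h)

disjoint-mono : p ⊆ r → q ⊆ s → r ∩ s ≡ ⊥ → p ∩ q ≡ ⊥
disjoint-mono {p = p} {q = q} p⊆r q⊆s r∩s≡⊥ = ⊆-antisym ⊆⊥ ⊥⊆
  where
  ⊆⊥ : p ∩ q ⊆ ⊥
  ⊆⊥ h = let (hp , hq) = x∈p∩q⁻ p q h in subst (_ ∈_) r∩s≡⊥ (x∈p∩q⁺ (p⊆r hp , q⊆s hq))

p⊆q∪r⇒p─r≡p∩q : p ⊆ q ∪ r → q ∩ r ≡ ⊥ → p ─ r ≡ p ∩ q
p⊆q∪r⇒p─r≡p∩q {p = p} {q = q} {r = r} p⊆q∪r q∩r≡⊥ = ⊆-antisym ─⊆∩ ∩⊆─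
  where
  ─⊆∩ : p ─ r ⊆ p ∩ q
  ─⊆∩ h = let hp = p─q⊆p p r h in
    x∈p∩q⁺ (hp , [ id , (λ hr → contradiction hr (x∈p─q⇒x∉q p r h)) ]′ (x∈p∪q⁻ q r (p⊆q∪r hp)))
  ∩⊆─ : p ∩ q ⊆ p ─ r
  ∩⊆─ h = let (hp , hq) = x∈p∩q⁻ p q h in
    x∈p∧x∉q⇒x∈p─q hp (λ hr → ∉⊥ (subst (_ ∈_) q∩r≡⊥ (x∈p∩q⁺ (hq , hr))))

∣p∣+∣q∣≡∣p∪q∣+∣p∩q∣ : ∀ (p q : Subset k) → ∣ p ∣ + ∣ q ∣ ≡ ∣ p ∪ q ∣ + ∣ p ∩ q ∣
∣p∣+∣q∣≡∣p∪q∣+∣p∩q∣ []            []            = refl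
∣p∣+∣q∣≡∣p∪q∣+∣p∩q∣ (outside ∷ p) (outside ∷ q) = ∣p∣+∣q∣≡∣p∪q∣+∣p∩q∣ p q
∣p∣+∣q∣≡∣p∪q∣+∣p∩q∣ (inside  ∷ p) (outside ∷ q) = cong suc (∣p∣+∣q∣≡∣p∪q∣+∣p∩q∣ p q)
∣p∣+∣q∣≡∣p∪q∣+∣p∩q∣ (outside ∷ p) (inside  ∷ q) =
  trans (+-suc ∣ p ∣ ∣ q ∣) (cong suc (∣p∣+∣q∣≡∣p∪q∣+∣p∩q∣ p q))
∣p∣+∣q∣≡∣p∪q∣+∣p∩q∣ (inside  ∷ p) (inside  ∷ q) = cong suc (begin
  ∣ p ∣ + suc ∣ q ∣             ≡⟨ +-suc ∣ p ∣ ∣ q ∣ ⟩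
  suc (∣ p ∣ + ∣ q ∣)           ≡⟨ cong suc (∣p∣+∣q∣≡∣p∪q∣+∣p∩q∣ p q) ⟩
  suc (∣ p ∪ q ∣ + ∣ p ∩ q ∣)   ≡⟨ +-suc ∣ p ∪ q ∣ ∣ p ∩ q ∣ ⟨
  ∣ p ∪ q ∣ + suc ∣ p ∩ q ∣     ∎)
  where open ≡-Reasoning

∣p∣+∣q∣≤∣r∣+∣s∣ : p ⊆ r ∪ s → q ⊆ r ∪ s → p ∩ q ⊆ r ∩ s → ∣ p ∣ + ∣ q ∣ ≤ ∣ r ∣ + ∣ s ∣
∣p∣+∣q∣≤∣r∣+∣s∣ {p = p} {r = r} {s = s} {q = q} p⊆r∪s q⊆r∪s p∩q⊆r∩s = begin
  ∣ p ∣ + ∣ q ∣         ≡⟨ ∣p∣+∣q∣≡∣p∪q∣+∣p∩q∣ p q ⟩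
  ∣ p ∪ q ∣ + ∣ p ∩ q ∣ ≤⟨ +-mono-≤ (p⊆q⇒∣p∣≤∣q∣ p∪q⊆r∪s) (p⊆q⇒∣p∣≤∣q∣ p∩q⊆r∩s) ⟩
  ∣ r ∪ s ∣ + ∣ r ∩ s ∣ ≡⟨ ∣p∣+∣q∣≡∣p∪q∣+∣p∩q∣ r s ⟨
  ∣ r ∣ + ∣ s ∣         ∎
  where
  open ≤-Reasoning
  p∪q⊆r∪s : p ∪ q ⊆ r ∪ s
  p∪q⊆r∪s = [ p⊆r∪s , q⊆r∪s ]′ ∘ x∈p∪q⁻ p q

m+n≤o+p⇒p≤n⇒m≤o : ∀ {m n o p} → m + n ≤ o + p → p ≤ n → m ≤ o
m+n≤o+p⇒p≤n⇒m≤o {m} {n} {o} m+n≤o+p p≤n = +-cancelʳ-≤ n m o (≤-trans m+n≤o+p (+-monoʳ-≤ o p≤n))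

module _ (G : Hypergraph) where

  private
    variable
      X Y : Subset (m G)
      v : Fin (n G)

    incIn : Subset (m G) → Fin (m G) → Subset (n G)
    incIn X e = if lookup X e then inc G e else ⊥

  ∈-Vof⁻ : v ∈ Vof G X → ∃ λ e → e ∈ X × v ∈ inc G e
  ∈-Vof⁻ {X = X} h =
    let (e , h′) = satisfied (map⁻ {f = incIn X} (x∈⋃⁻ (map (incIn X) (allFin (m G))) h))
        (Xe , v∈e) = x∈if⊥⁻ (lookup X e) h′
    in e , lookup⇒[]= e X Xe , v∈e

  ∈-Vof⁺ : ∀ {e} → e ∈ X → v ∈ inc G e → v ∈ Vof G X
  ∈-Vof⁺ {X = X} {e = e} e∈X v∈e =
    x∈⋃⁺ (map⁺ (lose (∈-allFin e)
      (subst (λ b → _ ∈ (if b then inc G e else ⊥)) (sym ([]=⇒lookup e∈X)) v∈e)))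

  Vof-mono : X ⊆ Y → Vof G X ⊆ Vof G Y
  Vof-mono X⊆Y h = let (e , e∈X , v∈e) = ∈-Vof⁻ h in ∈-Vof⁺ (X⊆Y e∈X) v∈e

  Vof-∪⁻ : ∀ X Y → v ∈ Vof G (X ∪ Y) → v ∈ Vof G X ⊎ v ∈ Vof G Y
  Vof-∪⁻ X Y h =
    let (e , e∈X∪Y , v∈e) = ∈-Vof⁻ h
    in Sum.map (λ e∈X → ∈-Vof⁺ e∈X v∈e) (λ e∈Y → ∈-Vof⁺ e∈Y v∈e) (x∈p∪q⁻ X Y e∈X∪Y)

  compl-antitone : ∀ X Y → X ⊆ Y → compl G Y ⊆ compl G X
  compl-antitone _ _ X⊆Y h = x∈p∧x∉q⇒x∈p─q (p─q⊆p _ _ h) (x∈p─q⇒x∉q _ _ h ∘ X⊆Y)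

  compl-∩ : ∀ X Y → compl G (X ∩ Y) ⊆ compl G X ∪ compl G Y
  compl-∩ X Y {e} h with e ∈? X
  ... | yes e∈X = x∈p∪q⁺ (inj₂ (x∈p∧x∉q⇒x∈p─q (p─q⊆p _ _ h)
                      (λ e∈Y → x∈p─q⇒x∉q _ _ h (x∈p∩q⁺ (e∈X , e∈Y)))))
  ... | no  e∉X = x∈p∪q⁺ (inj₁ (x∈p∧x∉q⇒x∈p─q (p─q⊆p _ _ h) e∉X))

  compl-─ : ∀ X Y → compl G (X ─ Y) ⊆ compl G X ∪ Y
  compl-─ X Y {e} h with e ∈? Y
  ... | yes e∈Y = x∈p∪q⁺ (inj₂ e∈Y)
  ... | no  e∉Y = x∈p∪q⁺ (inj₁ (x∈p∧x∉q⇒x∈p─q (p─q⊆p _ _ h)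
                      (λ e∈X → x∈p─q⇒x∉q _ _ h (x∈p∧x∉q⇒x∈p─q e∈X e∉Y))))

  lam-submodular : ∀ X Y → lam G (X ∪ Y) + lam G (X ∩ Y) ≤ lam G X + lam G Y
  lam-submodular X Y = ∣p∣+∣q∣≤∣r∣+∣s∣ bd-∪ bd-∩ bd-∪∩bd-∩
    where
    c∪⊆cX : Vof G (compl G (X ∪ Y)) ⊆ Vof G (compl G X)
    c∪⊆cX = Vof-mono (compl-antitone X (X ∪ Y) (p⊆p∪q Y))
    c∪⊆cY : Vof G (compl G (X ∪ Y)) ⊆ Vof G (compl G Y)
    c∪⊆cY = Vof-mono (compl-antitone Y (X ∪ Y) (q⊆p∪q X Y))
    ∩⊆X : Vof G (X ∩ Y) ⊆ Vof G X
    ∩⊆X = Vof-mono (p∩q⊆p X Y)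
    ∩⊆Y : Vof G (X ∩ Y) ⊆ Vof G Y
    ∩⊆Y = Vof-mono (p∩q⊆q X Y)

    bd-∪ : bd G (X ∪ Y) ⊆ bd G X ∪ bd G Y
    bd-∪ h = let (h₁ , h₂) = x∈p∩q⁻ _ _ h in x∈p∪q⁺ (Sum.map
      (λ hX → x∈p∩q⁺ (hX , c∪⊆cX h₂)) (λ hY → x∈p∩q⁺ (hY , c∪⊆cY h₂)) (Vof-∪⁻ X Y h₁))

    bd-∩ : bd G (X ∩ Y) ⊆ bd G X ∪ bd G Y
    bd-∩ h = let (h₁ , h₂) = x∈p∩q⁻ _ _ h in x∈p∪q⁺ (Sum.map
      (λ hX → x∈p∩q⁺ (∩⊆X h₁ , hX)) (λ hY → x∈p∩q⁺ (∩⊆Y h₁ , hY))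
      (Vof-∪⁻ (compl G X) (compl G Y) (Vof-mono (compl-∩ X Y) h₂)))

    bd-∪∩bd-∩ : bd G (X ∪ Y) ∩ bd G (X ∩ Y) ⊆ bd G X ∩ bd G Y
    bd-∪∩bd-∩ h =
      let (h∪ , h∩) = x∈p∩q⁻ _ _ h
          c∪ = proj₂ (x∈p∩q⁻ _ _ h∪)
          v∩ = proj₁ (x∈p∩q⁻ _ _ h∩)
      in x∈p∩q⁺ (x∈p∩q⁺ (∩⊆X v∩ , c∪⊆cX c∪) , x∈p∩q⁺ (∩⊆Y v∩ , c∪⊆cY c∪))

  lam-posimodular : ∀ {X Y} → X ⊆ EG G → Y ⊆ EG G →
    lam G (X ─ Y) + lam G (Y ─ X) ≤ lam G X + lam G Y
  lam-posimodular {X} {Y} X⊆E Y⊆E =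
    ∣p∣+∣q∣≤∣r∣+∣s∣ (bd-─ X⊆E)
      (subst (bd G (Y ─ X) ⊆_) (∪-comm (bd G Y) (bd G X)) (bd-─ Y⊆E))
      (λ h → let (hXY , hYX) = x∈p∩q⁻ _ _ h
                 vXY = proj₁ (x∈p∩q⁻ _ _ hXY)
                 vYX = proj₁ (x∈p∩q⁻ _ _ hYX)
             in x∈p∩q⁺ (∈bd Y⊆E vXY vYX , ∈bd X⊆E vYX vXY))
    where
    ∈bd : ∀ {X Y} {v : Fin (n G)} → Y ⊆ EG G →
      v ∈ Vof G (X ─ Y) → v ∈ Vof G (Y ─ X) → v ∈ bd G X
    ∈bd {X} {Y} Y⊆E vXY vYX =
      x∈p∩q⁺ (Vof-mono (p─q⊆p X Y) vXY , Vof-mono (─-monoˡ {r = X} Y⊆E) vYX)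

    bd-─ : ∀ {X Y} → X ⊆ EG G → bd G (X ─ Y) ⊆ bd G X ∪ bd G Y
    bd-─ {X} {Y} X⊆E h =
      let (vXY , cXY) = x∈p∩q⁻ _ _ h
      in x∈p∪q⁺ (Sum.map
           (λ cX → x∈p∩q⁺ (Vof-mono (p─q⊆p X Y) vXY , cX))
           (λ vY → x∈p∩q⁺ (vY , Vof-mono (─-monoˡ {r = Y} X⊆E) vXY))
           (Vof-∪⁻ (compl G X) Y (Vof-mono (compl-─ X Y) cXY)))

module _ (G : Hypergraph) (A : Subset (m G)) where

  private
    variable
      X W : Subset (m G)
      v : Fin (n G)

  ∈-Vof-◁-inside⁻ : v ∈ Vof (G ◁ A) (inside ∷ X) → v ∈ bd G A ⊎ v ∈ Vof G X
  ∈-Vof-◁-inside⁻ {X = X} h with ∈-Vof⁻ (G ◁ A) {X = inside ∷ X} h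
  ... | zero  , here      , v∈e = inj₁ v∈e
  ... | suc e , there e∈X , v∈e = inj₂ (∈-Vof⁺ G e∈X v∈e)

  ∈-Vof-◁-outside⁻ : v ∈ Vof (G ◁ A) (outside ∷ X) → v ∈ Vof G X
  ∈-Vof-◁-outside⁻ {X = X} h with ∈-Vof⁻ (G ◁ A) {X = outside ∷ X} h
  ... | suc e , there e∈X , v∈e = ∈-Vof⁺ G e∈X v∈e

  Vof⊆Vof-◁ : ∀ {b} → Vof G X ⊆ Vof (G ◁ A) (b ∷ X)
  Vof⊆Vof-◁ h = let (e , e∈X , v∈e) = ∈-Vof⁻ G h in ∈-Vof⁺ (G ◁ A) (there e∈X) v∈e

  bd⊆Vof-◁ : bd G A ⊆ Vof (G ◁ A) (inside ∷ X)
  bd⊆Vof-◁ = ∈-Vof⁺ (G ◁ A) here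

  Vof-◁-∩ : W ⊆ compl G A →
    Vof (G ◁ A) (inside ∷ X) ∩ Vof (G ◁ A) (outside ∷ W) ≡ Vof G (X ∪ A) ∩ Vof G W
  Vof-◁-∩ {W = W} {X = X} W⊆cA = ⊆-antisym ⊆ʳ ⊆ˡ
    where
    ⊆ʳ : Vof (G ◁ A) (inside ∷ X) ∩ Vof (G ◁ A) (outside ∷ W) ⊆ Vof G (X ∪ A) ∩ Vof G W
    ⊆ʳ h = let (h₁ , h₂) = x∈p∩q⁻ _ _ h in x∈p∩q⁺
      ( [ Vof-mono G (q⊆p∪q X A) ∘ proj₁ ∘ x∈p∩q⁻ _ _ , Vof-mono G (p⊆p∪q {p = X} A) ]′
          (∈-Vof-◁-inside⁻ h₁)
      , ∈-Vof-◁-outside⁻ h₂ )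
    ⊆ˡ : Vof G (X ∪ A) ∩ Vof G W ⊆ Vof (G ◁ A) (inside ∷ X) ∩ Vof (G ◁ A) (outside ∷ W)
    ⊆ˡ h = let (h₁ , h₂) = x∈p∩q⁻ _ _ h in x∈p∩q⁺
      ( [ Vof⊆Vof-◁ {X = X} , (λ vA → bd⊆Vof-◁ (x∈p∩q⁺ (vA , Vof-mono G W⊆cA h₂))) ]′
          (Vof-∪⁻ G X A h₁)
      , Vof⊆Vof-◁ h₂ )

  bd-◁ : A ⊆ EG G → ∀ Y → Y ⊆ EG (G ◁ A) → bd (G ◁ A) Y ≡ bd G (_▷_ {G} Y A)
  bd-◁ _ (inside ∷ X) _ = begin
    Vof (G ◁ A) (inside ∷ X) ∩ Vof (G ◁ A) (outside ∷ (compl G A ─ X))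
      ≡⟨ Vof-◁-∩ (p─q⊆p (compl G A) X) ⟩
    Vof G (X ∪ A) ∩ Vof G (EG G ─ A ─ X)
      ≡⟨ cong (λ W → Vof G (X ∪ A) ∩ Vof G W)
           (trans (p─q─r≡p─q∪r (EG G) A X) (cong (EG G ─_) (∪-comm A X))) ⟩
    bd G (X ∪ A) ∎
    where open ≡-Reasoning
  bd-◁ A⊆E (outside ∷ X) Y⊆ = begin
    Vof (G ◁ A) (outside ∷ X) ∩ Vof (G ◁ A) (inside ∷ (compl G A ─ X))
      ≡⟨ ∩-comm _ _ ⟩
    Vof (G ◁ A) (inside ∷ (compl G A ─ X)) ∩ Vof (G ◁ A) (outside ∷ X)
      ≡⟨ Vof-◁-∩ (drop-∷-⊆ Y⊆) ⟩
    Vof G ((EG G ─ A ─ X) ∪ A) ∩ Vof G X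
      ≡⟨ ∩-comm _ _ ⟩
    Vof G X ∩ Vof G ((EG G ─ A ─ X) ∪ A)
      ≡⟨ cong (λ W → Vof G X ∩ Vof G W) (p─q─r∪q≡p─r A⊆E (drop-∷-⊆ Y⊆)) ⟩
    bd G X ∎
    where open ≡-Reasoning

  lam-◁ : A ⊆ EG G → ∀ {Y} → Y ⊆ EG (G ◁ A) → lam (G ◁ A) Y ≡ lam G (_▷_ {G} Y A)
  lam-◁ A⊆E {Y} Y⊆ = cong ∣_∣ (bd-◁ A⊆E Y Y⊆)

module _ (G : Hypergraph) (A : Subset (m G)) (A⊆E : A ⊆ EG G) where

  wellLinked-▷-outside : ∀ B → B ⊆ compl G A →
    WellLinked (G ◁ A) (outside ∷ B) → WellLinked G B
  wellLinked-▷-outside B B⊆cA wlB C₁ C₂ C₁∩C₂≡⊥ C₁∪C₂≡B =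
    Sum.map (subst₂ _≤_ (lam-◁ G A A⊆E (out⊆ B⊆cA)) (lam-◁ G A A⊆E (out⊆ C₁⊆cA)))
            (subst₂ _≤_ (lam-◁ G A A⊆E (out⊆ B⊆cA)) (lam-◁ G A A⊆E (out⊆ C₂⊆cA)))
            (wlB (outside ∷ C₁) (outside ∷ C₂)
                 (cong (outside ∷_) C₁∩C₂≡⊥) (cong (outside ∷_) C₁∪C₂≡B))
    where
    C₁⊆cA : C₁ ⊆ compl G A
    C₁⊆cA = B⊆cA ∘ subst (_ ∈_) C₁∪C₂≡B ∘ p⊆p∪q C₂
    C₂⊆cA : C₂ ⊆ compl G A
    C₂⊆cA = B⊆cA ∘ subst (_ ∈_) C₁∪C₂≡B ∘ q⊆p∪q C₁ C₂

  wellLinked-▷-inside-split : ∀ B → B ⊆ compl G A → WellLinked (G ◁ A) (inside ∷ B) →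
    ∀ C₁ C₂ → C₁ ∩ C₂ ≡ ⊥ → C₁ ∪ C₂ ≡ B ∪ A → lam G (A ∩ C₁) ≥ lam G A →
    lam G C₁ ≥ lam G (B ∪ A) ⊎ lam G C₂ ≥ lam G (B ∪ A)
  wellLinked-▷-inside-split B B⊆cA wlB C₁ C₂ C₁∩C₂≡⊥ C₁∪C₂≡B∪A λA≤λA∩C₁ =
    Sum.map (λ h → ≤-trans (subst₂ _≤_ λB λD₁ h) λD₁≤λC₁)
            (λ h → ≤-trans (subst₂ _≤_ λB λD₂ h) λD₂≤λC₂)
            (wlB (inside ∷ (C₁ ─ A)) (outside ∷ (C₂ ─ A)) D₁∩D₂≡⊥ D₁∪D₂≡B)
    where
    C₁∪C₂⊆E : C₁ ∪ C₂ ⊆ EG G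
    C₁∪C₂⊆E h = [ p─q⊆p (EG G) A ∘ B⊆cA , A⊆E ]′ (x∈p∪q⁻ B A (subst (_ ∈_) C₁∪C₂≡B∪A h))

    D₁∩D₂≡⊥ : (inside ∷ (C₁ ─ A)) ∩ (outside ∷ (C₂ ─ A)) ≡ ⊥
    D₁∩D₂≡⊥ = cong (outside ∷_) (disjoint-mono (p─q⊆p C₁ A) (p─q⊆p C₂ A) C₁∩C₂≡⊥)

    D₁∪D₂≡B : (inside ∷ (C₁ ─ A)) ∪ (outside ∷ (C₂ ─ A)) ≡ inside ∷ B
    D₁∪D₂≡B = cong (inside ∷_) (begin
      (C₁ ─ A) ∪ (C₂ ─ A) ≡⟨ ─-distribʳ-∪ C₁ C₂ A ⟨
      (C₁ ∪ C₂) ─ A       ≡⟨ cong (_─ A) C₁∪C₂≡B∪A ⟩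
      (B ∪ A) ─ A         ≡⟨ p⊆r─q⇒p∪q─q≡p B⊆cA ⟩
      B                   ∎)
      where open ≡-Reasoning

    λB : lam (G ◁ A) (inside ∷ B) ≡ lam G (B ∪ A)
    λB = lam-◁ G A A⊆E (in⊆in B⊆cA)
    λD₁ : lam (G ◁ A) (inside ∷ (C₁ ─ A)) ≡ lam G ((C₁ ─ A) ∪ A)
    λD₁ = lam-◁ G A A⊆E (in⊆in (─-monoˡ (C₁∪C₂⊆E ∘ p⊆p∪q C₂)))
    λD₂ : lam (G ◁ A) (outside ∷ (C₂ ─ A)) ≡ lam G (C₂ ─ A)
    λD₂ = lam-◁ G A A⊆E (out⊆ (─-monoˡ (C₁∪C₂⊆E ∘ q⊆p∪q C₁ C₂)))

    λD₁≤λC₁ : lam G ((C₁ ─ A) ∪ A) ≤ lam G C₁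
    λD₁≤λC₁ rewrite p─q∪q≡p∪q C₁ A =
      m+n≤o+p⇒p≤n⇒m≤o (lam-submodular G C₁ A)
        (subst (λ Z → lam G A ≤ lam G Z) (∩-comm A C₁) λA≤λA∩C₁)

    λD₂≤λC₂ : lam G (C₂ ─ A) ≤ lam G C₂
    λD₂≤λC₂ = m+n≤o+p⇒p≤n⇒m≤o (lam-posimodular G (C₁∪C₂⊆E ∘ q⊆p∪q C₁ C₂) A⊆E)
      (subst (λ Z → lam G A ≤ lam G Z) (sym A─C₂≡A∩C₁) λA≤λA∩C₁)
      where
      A─C₂≡A∩C₁ : A ─ C₂ ≡ A ∩ C₁
      A─C₂≡A∩C₁ = p⊆q∪r⇒p─r≡p∩q
        (subst (_ ∈_) (sym C₁∪C₂≡B∪A) ∘ q⊆p∪q B A) C₁∩C₂≡⊥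

  wellLinked-▷-inside : ∀ B → B ⊆ compl G A → WellLinked G A →
    WellLinked (G ◁ A) (inside ∷ B) → WellLinked G (B ∪ A)
  wellLinked-▷-inside B B⊆cA wlA wlB C₁ C₂ C₁∩C₂≡⊥ C₁∪C₂≡B∪A
    with wlA (A ∩ C₁) (A ∩ C₂) (disjoint-mono (p∩q⊆q A C₁) (p∩q⊆q A C₂) C₁∩C₂≡⊥) A∩C₁∪A∩C₂≡A
    where
    A∩C₁∪A∩C₂≡A : (A ∩ C₁) ∪ (A ∩ C₂) ≡ A
    A∩C₁∪A∩C₂≡A = begin
      (A ∩ C₁) ∪ (A ∩ C₂) ≡⟨ ∩-distribˡ-∪ A C₁ C₂ ⟨
      A ∩ (C₁ ∪ C₂)       ≡⟨ cong (A ∩_) (trans C₁∪C₂≡B∪A (∪-comm B A)) ⟩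
      A ∩ (A ∪ B)         ≡⟨ ∩-abs-∪ A B ⟩
      A                   ∎
      where open ≡-Reasoning
  ... | inj₁ h = wellLinked-▷-inside-split B B⊆cA wlB C₁ C₂ C₁∩C₂≡⊥ C₁∪C₂≡B∪A h
  ... | inj₂ h = swap (wellLinked-▷-inside-split B B⊆cA wlB C₂ C₁
                   (trans (∩-comm C₂ C₁) C₁∩C₂≡⊥) (trans (∪-comm C₂ C₁) C₁∪C₂≡B∪A) h)

lemma6p3 : (G : Hypergraph) → WellFormed G →
    (A : Subset (m G)) → A ⊆ EG G → WellLinked G A →
    (B : Subset (m (G ◁ A))) → B ⊆ EG (G ◁ A) → WellLinked (G ◁ A) B →
    WellLinked G (_▷_ {G} B A)
lemma6p3 G _ A A⊆E wlA (outside ∷ B) B⊆ wlB = wellLinked-▷-outside G A A⊆E B (drop-∷-⊆ B⊆) wlB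
lemma6p3 G _ A A⊆E wlA (inside  ∷ B) B⊆ wlB = wellLinked-▷-inside G A A⊆E B (drop-∷-⊆ B⊆) wlA wlB
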